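{- Let $S$ be a finite set of complex numbers and let $c:S\to\mathbb{C}$ be any function. Then for every $n\ge 0$, \[\det\left(\left(\sum_{r\in S}c(r)\binom{ri}{j}\right)_{i,j=0}^{n}\right)=\prod_{j=0}^{n}\left(\sum_{r\in S}c(r)\,r^j\right).\]
   Context: For complex $w$ and integer $j\ge0$, $\binom{w}{j}=w(w-1)\cdots(w-j+1)/j!$; the convention $0^0=1$ is used. -}

module Defs where

open import Level using (Level; _⊔_) renaming (suc to lsuc)
open import Data.Nat using (ℕ; zero; suc; NonZero; _!)
open import Data.Nat.Properties using (_!≢0)
open import Data.Fin using (Fin; zero; suc; toℕ; punchIn)
open import Algebra.Bundles using (CommutativeRing)
open import Relation.Nullary using (¬_)

ringFromℕ : ∀ {a ℓ} (R : CommutativeRing a ℓ) → ℕ → CommutativeRing.Carrier R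
ringFromℕ R zero    = CommutativeRing.0# R
ringFromℕ R (suc n) = CommutativeRing._+_ R (CommutativeRing.1# R) (ringFromℕ R n)

-- A field of characteristic zero (the statement is about ℂ).
record CharZeroField (a ℓ : Level) : Set (lsuc (a ⊔ ℓ)) where
  field
    commutativeRing : CommutativeRing a ℓ
  open CommutativeRing commutativeRing

  field
    charZero : ∀ n → .{{_ : NonZero n}} → ¬ (ringFromℕ commutativeRing n ≈ 0#)
    inv      : (x : Carrier) → ¬ (x ≈ 0#) → Carrier
    inv-law  : ∀ x (p : ¬ (x ≈ 0#)) → x * inv x p ≈ 1#

module CZF {a ℓ : Level} (F : CharZeroField a ℓ) where
  open CharZeroField F public
  open CommutativeRing commutativeRing public hiding (zero)

  fromℕ : ℕ → Carrier
  fromℕ = ringFromℕ commutativeRing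

  ∑ : ∀ m → (Fin m → Carrier) → Carrier
  ∑ zero    f = 0#
  ∑ (suc m) f = f zero + ∑ m (λ k → f (suc k))

  ∏ : ∀ m → (Fin m → Carrier) → Carrier
  ∏ zero    f = 1#
  ∏ (suc m) f = f zero * ∏ m (λ k → f (suc k))

  -- powers, with x ^ 0 = 1 (so 0 ^ 0 = 1)
  _^_ : Carrier → ℕ → Carrier
  x ^ zero  = 1#
  x ^ suc n = x * (x ^ n)

  falling : Carrier → ℕ → Carrier
  falling w j = ∏ j (λ k → w - fromℕ (toℕ k))

  binom : Carrier → ℕ → Carrier
  binom w j = falling w j * inv (fromℕ (j !)) (charZero (j !) {{j !≢0}})

  det : ∀ n → (Fin n → Fin n → Carrier) → Carrier
  det zero    A = 1#
  det (suc n) A =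
    ∑ (suc n) (λ j → ((- 1#) ^ toℕ j) * (A zero j * det n (λ i k → A (suc i) (punchIn j k))))

module Submission where

-- Column j is the function i ↦ ∑ c(r) (r i choose j), a polynomial in i of degree at most j whose
-- coefficient of i ^ j is ∑ c(r) r ^ j / j!. For any matrix (q j i) with such polynomial columns,
-- replacing every row by its difference with the previous one leaves the determinant unchanged,
-- kills the first column below its top entry q 0 0 (as q 0 is constant), and turns the other
-- columns into the forward differences Δ (q (j + 1)), again of degree at most j and with leading
-- coefficient multiplied by j + 1. Expanding along the first column and inducting gives
-- det = ∏ j! · (leading coefficient of q j).

open import Defs
open import Level using (Level; _⊔_)
open import Function using (_∘_)
open import Data.Maybe using (Maybe; just; nothing)
open import Data.Nat as ℕ using (ℕ; zero; suc; _!)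
open import Data.Nat.Properties using (_!≢0; +-suc)
open import Data.Integer as ℤ using (ℤ; +_; -[1+_]; _⊖_)
import Data.Integer.Properties as ℤ
open import Data.Fin using (Fin; zero; suc; toℕ; punchIn; inject₁; lift)
open import Data.Fin.Properties using (toℕ-inject₁)
open import Data.Vec.Functional using (_∷_; tail)
open import Relation.Binary.PropositionalEquality as ≡ using (_≡_; _≗_)
open import Relation.Nullary using (yes; no)
open import Algebra.Bundles using (CommutativeRing)
open import Algebra.Solver.Ring.AlmostCommutativeRing
  using (fromCommutativeRing; _-Raw-AlmostCommutative⟶_)
import Algebra.Solver.Ring

module BinomialDeterminant {a ℓ : Level} (F : CharZeroField a ℓ) where
  open CZF F
  open import Algebra.Properties.Ring ring
    using (-‿involutive; -‿distribˡ-*; -‿distribʳ-*; -0#≈0#; -‿+-comm)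
  open import Algebra.Properties.CommutativeSemigroup +-commutativeSemigroup
    using (interchange)
  open import Algebra.Properties.CommutativeSemigroup *-commutativeSemigroup
    using (x∙yz≈yx∙z; x∙yz≈y∙xz)
  open import Algebra.Properties.Semiring.Mult.TCOptimised semiring
    using (_×_; 1+×; ×-homo-+; ×1-homo-*)
  open import Relation.Binary.Reasoning.Setoid setoid

  -- Integer coefficients let the ring solver compute with the constants ± 1 of signs and cancellations.
  ⟦_⟧ℤ : ℤ → Carrier
  ⟦ + n ⟧ℤ      = n × 1#
  ⟦ -[1+ n ] ⟧ℤ = - (suc n × 1#)

  ⟦-+⟧ℤ : ∀ n → ⟦ ℤ.- (+ n) ⟧ℤ ≈ - (n × 1#)
  ⟦-+⟧ℤ zero    = sym -0#≈0#
  ⟦-+⟧ℤ (suc n) = refl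

  ⟦⊖⟧ℤ : ∀ m n → ⟦ m ⊖ n ⟧ℤ ≈ m × 1# - n × 1#
  ⟦⊖⟧ℤ m       zero    = sym (trans (+-congˡ -0#≈0#) (+-identityʳ _))
  ⟦⊖⟧ℤ zero    (suc n) = sym (+-identityˡ _)
  ⟦⊖⟧ℤ (suc m) (suc n) = begin
    ⟦ suc m ⊖ suc n ⟧ℤ                   ≡⟨ ≡.cong ⟦_⟧ℤ (ℤ.[1+m]⊖[1+n]≡m⊖n m n) ⟩
    ⟦ m ⊖ n ⟧ℤ                           ≈⟨ ⟦⊖⟧ℤ m n ⟩
    m × 1# - n × 1#                      ≈⟨ +-identityˡ _ ⟨
    0# + (m × 1# - n × 1#)               ≈⟨ +-congʳ (-‿inverseʳ 1#) ⟨
    (1# - 1#) + (m × 1# - n × 1#)        ≈⟨ interchange _ _ _ _ ⟩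
    (1# + m × 1#) + (- 1# - n × 1#)      ≈⟨ +-congˡ (-‿+-comm 1# _) ⟩
    (1# + m × 1#) - (1# + n × 1#)        ≈⟨ +-cong (1+× m 1#) (-‿cong (1+× n 1#)) ⟨
    suc m × 1# - suc n × 1#              ∎

  ⟦+⟧ℤ : ∀ i j → ⟦ i ℤ.+ j ⟧ℤ ≈ ⟦ i ⟧ℤ + ⟦ j ⟧ℤ
  ⟦+⟧ℤ (+ m)      (+ n)      = ×-homo-+ 1# m n
  ⟦+⟧ℤ (+ m)      -[1+ n ]   = ⟦⊖⟧ℤ m (suc n)
  ⟦+⟧ℤ -[1+ m ]   (+ n)      = trans (⟦⊖⟧ℤ n (suc m)) (+-comm _ _)
  ⟦+⟧ℤ -[1+ m ]   -[1+ n ]   = begin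
    - (suc (suc (m ℕ.+ n)) × 1#)        ≡⟨ ≡.cong (λ k → - (suc k × 1#)) (+-suc m n) ⟨
    - ((suc m ℕ.+ suc n) × 1#)          ≈⟨ -‿cong (×-homo-+ 1# (suc m) (suc n)) ⟩
    - (suc m × 1# + suc n × 1#)         ≈⟨ -‿+-comm _ _ ⟨
    - (suc m × 1#) - suc n × 1#         ∎

  ⟦-⟧ℤ : ∀ i → ⟦ ℤ.- i ⟧ℤ ≈ - ⟦ i ⟧ℤ
  ⟦-⟧ℤ (+ n)      = ⟦-+⟧ℤ n
  ⟦-⟧ℤ -[1+ n ]   = sym (-‿involutive _)

  ⟦*⟧ℤ : ∀ i j → ⟦ i ℤ.* j ⟧ℤ ≈ ⟦ i ⟧ℤ * ⟦ j ⟧ℤ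
  ⟦*⟧ℤ (+ m) (+ n) = begin
    ⟦ + m ℤ.* + n ⟧ℤ                     ≡⟨ ≡.cong ⟦_⟧ℤ (ℤ.+◃n≡+n (m ℕ.* n)) ⟩
    (m ℕ.* n) × 1#                       ≈⟨ ×1-homo-* m n ⟩
    m × 1# * n × 1#                      ∎
  ⟦*⟧ℤ (+ m) -[1+ n ] = begin
    ⟦ + m ℤ.* -[1+ n ] ⟧ℤ                ≡⟨ ≡.cong ⟦_⟧ℤ (ℤ.-◃n≡-n (m ℕ.* suc n)) ⟩
    ⟦ ℤ.- (+ (m ℕ.* suc n)) ⟧ℤ           ≈⟨ ⟦-+⟧ℤ (m ℕ.* suc n) ⟩
    - ((m ℕ.* suc n) × 1#)               ≈⟨ -‿cong (×1-homo-* m (suc n)) ⟩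
    - (m × 1# * suc n × 1#)              ≈⟨ -‿distribʳ-* _ _ ⟩
    m × 1# * - (suc n × 1#)              ∎
  ⟦*⟧ℤ -[1+ m ] (+ n) = begin
    ⟦ -[1+ m ] ℤ.* + n ⟧ℤ                ≡⟨ ≡.cong ⟦_⟧ℤ (ℤ.-◃n≡-n (suc m ℕ.* n)) ⟩
    ⟦ ℤ.- (+ (suc m ℕ.* n)) ⟧ℤ           ≈⟨ ⟦-+⟧ℤ (suc m ℕ.* n) ⟩
    - ((suc m ℕ.* n) × 1#)               ≈⟨ -‿cong (×1-homo-* (suc m) n) ⟩
    - (suc m × 1# * n × 1#)              ≈⟨ -‿distribˡ-* _ _ ⟩
    - (suc m × 1#) * n × 1#              ∎
  ⟦*⟧ℤ -[1+ m ] -[1+ n ] = begin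
    ⟦ -[1+ m ] ℤ.* -[1+ n ] ⟧ℤ           ≡⟨ ≡.cong ⟦_⟧ℤ (ℤ.+◃n≡+n (suc m ℕ.* suc n)) ⟩
    (suc m ℕ.* suc n) × 1#               ≈⟨ ×1-homo-* (suc m) (suc n) ⟩
    x * y                                ≈⟨ -‿involutive _ ⟨
    - - (x * y)                          ≈⟨ -‿cong (-‿distribˡ-* x y) ⟩
    - (- x * y)                          ≈⟨ -‿distribʳ-* (- x) y ⟩
    - x * - y                            ∎
    where x = suc m × 1#; y = suc n × 1#

  integerCoefficients : CommutativeRing.rawRing ℤ.+-*-commutativeRing
                          -Raw-AlmostCommutative⟶ fromCommutativeRing commutativeRing
  integerCoefficients = record
    { ⟦_⟧    = ⟦_⟧ℤ
    ; +-homo = ⟦+⟧ℤ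
    ; *-homo = ⟦*⟧ℤ
    ; -‿homo = ⟦-⟧ℤ
    ; 0-homo = refl
    ; 1-homo = refl
    }

  ⟦_⟧ℤ-≟_ : ∀ i j → Maybe (⟦ i ⟧ℤ ≈ ⟦ j ⟧ℤ)
  ⟦ i ⟧ℤ-≟ j with i ℤ.≟ j
  ... | yes ≡.refl = just refl
  ... | no _       = nothing

  open Algebra.Solver.Ring _ _ integerCoefficients ⟦_⟧ℤ-≟_

  fromℕ≈×1 : ∀ n → fromℕ n ≈ n × 1#
  fromℕ≈×1 zero    = refl
  fromℕ≈×1 (suc n) = trans (+-congˡ (fromℕ≈×1 n)) (sym (1+× n 1#))

  fromℕ-homo-* : ∀ m n → fromℕ (m ℕ.* n) ≈ fromℕ m * fromℕ n
  fromℕ-homo-* m n = begin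
    fromℕ (m ℕ.* n)        ≈⟨ fromℕ≈×1 (m ℕ.* n) ⟩
    (m ℕ.* n) × 1#         ≈⟨ ×1-homo-* m n ⟩
    m × 1# * n × 1#        ≈⟨ *-cong (fromℕ≈×1 m) (fromℕ≈×1 n) ⟨
    fromℕ m * fromℕ n      ∎

  ∑-cong : ∀ m {f g : Fin m → Carrier} → (∀ k → f k ≈ g k) → ∑ m f ≈ ∑ m g
  ∑-cong zero    f≈g = refl
  ∑-cong (suc m) f≈g = +-cong (f≈g zero) (∑-cong m (f≈g ∘ suc))

  ∏-cong : ∀ m {f g : Fin m → Carrier} → (∀ k → f k ≈ g k) → ∏ m f ≈ ∏ m g
  ∏-cong zero    f≈g = refl
  ∏-cong (suc m) f≈g = *-cong (f≈g zero) (∏-cong m (f≈g ∘ suc))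

  ∑-zero : ∀ m {f : Fin m → Carrier} → (∀ k → f k ≈ 0#) → ∑ m f ≈ 0#
  ∑-zero zero    f≈0 = refl
  ∑-zero (suc m) f≈0 = trans (+-cong (f≈0 zero) (∑-zero m (f≈0 ∘ suc))) (+-identityʳ 0#)

  ∑-distrib-+ : ∀ m (f g : Fin m → Carrier) → ∑ m (λ k → f k + g k) ≈ ∑ m f + ∑ m g
  ∑-distrib-+ zero    f g = sym (+-identityʳ 0#)
  ∑-distrib-+ (suc m) f g =
    trans (+-congˡ (∑-distrib-+ m (f ∘ suc) (g ∘ suc))) (interchange _ _ _ _)

  ∑-distrib-− : ∀ m (f g : Fin m → Carrier) → ∑ m (λ k → f k - g k) ≈ ∑ m f - ∑ m g
  ∑-distrib-− zero    f g = sym (trans (+-congˡ -0#≈0#) (+-identityʳ 0#))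
  ∑-distrib-− (suc m) f g = begin
      (f zero - g zero) + ∑ m (λ k → f (suc k) - g (suc k))
    ≈⟨ +-congˡ (∑-distrib-− m (f ∘ suc) (g ∘ suc)) ⟩
      (f zero - g zero) + (∑ m (f ∘ suc) - ∑ m (g ∘ suc))
    ≈⟨ interchange _ _ _ _ ⟩
      (f zero + ∑ m (f ∘ suc)) + (- g zero - ∑ m (g ∘ suc))
    ≈⟨ +-congˡ (-‿+-comm _ _) ⟩
      ∑ (suc m) f - ∑ (suc m) g
    ∎

  *-distribˡ-∑ : ∀ m c (f : Fin m → Carrier) → c * ∑ m f ≈ ∑ m (λ k → c * f k)
  *-distribˡ-∑ zero    c f = zeroʳ c
  *-distribˡ-∑ (suc m) c f = trans (distribˡ c _ _) (+-congˡ (*-distribˡ-∑ m c (f ∘ suc)))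

  *-*-congˡ : ∀ x y {z w} → z ≈ w → x * (y * z) ≈ x * (y * w)
  *-*-congˡ x y z≈w = *-congˡ (*-congˡ z≈w)

  *-*-zeroʳ : ∀ x y {z} → z ≈ 0# → x * (y * z) ≈ 0#
  *-*-zeroʳ x y z≈0 = trans (*-congˡ (trans (*-congˡ z≈0) (zeroʳ y))) (zeroʳ x)

  Matrix : ℕ → Set a
  Matrix n = Fin n → Fin n → Carrier

  sign : ∀ {n} → Fin n → Carrier
  sign j = (- 1#) ^ toℕ j

  minor : ∀ {n} → Matrix (suc n) → Fin (suc n) → Matrix n
  minor A j i k = A (suc i) (punchIn j k)

  cofactorTerm : ∀ {n} → Matrix (suc n) → Fin (suc n) → Carrier
  cofactorTerm {n} A j = sign j * (A zero j * det n (minor A j))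

  det-cong : ∀ n {A B : Matrix n} → (∀ i j → A i j ≈ B i j) → det n A ≈ det n B
  det-cong zero    A≈B = refl
  det-cong (suc n) {A} {B} A≈B = ∑-cong (suc n) {cofactorTerm A} {cofactorTerm B} λ j →
    *-congˡ (*-cong (A≈B zero j) (det-cong n λ i k → A≈B (suc i) (punchIn j k)))

  det-row₀-− : ∀ n (u v : Fin (suc n) → Carrier) (B : Fin n → Fin (suc n) → Carrier) →
    det (suc n) ((λ j → u j - v j) ∷ B) ≈ det (suc n) (u ∷ B) - det (suc n) (v ∷ B)
  det-row₀-− n u v B =
    trans (∑-cong (suc n) λ j → expand-− (sign j) (u j) (v j) (D j))
          (∑-distrib-− (suc n) (λ j → sign j * (u j * D j)) (λ j → sign j * (v j * D j)))
    where
    D : Fin (suc n) → Carrier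
    D j = det n (λ i k → B i (punchIn j k))
    expand-− : ∀ s u v d → s * ((u - v) * d) ≈ s * (u * d) - s * (v * d)
    expand-− = solve 4 (λ s u v d → s :* ((u :- v) :* d) := s :* (u :* d) :- s :* (v :* d)) refl

  -- det (x ∷ x ∷ B) expanded twice along its first row, with W e the determinant of B restricted to
  -- the columns e; W is kept abstract so that the sum for x reduces to the one for tail x.
  pairExpansion : ∀ n → (Fin (suc (suc n)) → Carrier) →
    ((Fin n → Fin (suc (suc n))) → Carrier) → Carrier
  pairExpansion n x W = ∑ (suc (suc n)) λ j → sign j * (x j *
    ∑ (suc n) λ k → sign k * (x (punchIn j k) * W (punchIn j ∘ punchIn k)))

  -- The terms containing x zero (j = 0, and k = 0 for j ≠ 0) cancel in pairs as sign (suc j) = - sign j.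
  pairExpansion-cancel : ∀ n x W → pairExpansion n x W ≈
    ∑ (suc n) λ j → sign j * (x (suc j) *
      ∑ n λ k → sign k * (x (suc (punchIn j k)) * W (punchIn (suc j) ∘ punchIn (suc k))))
  pairExpansion-cancel n x W = begin
      1# * (x₀ * ∑ (suc n) U) + ∑ (suc n) (λ j → sign (suc j) * (y j * (1# * (x₀ * V j) + Q j)))
    ≈⟨ +-congˡ (∑-cong (suc n) split) ⟩
      1# * (x₀ * ∑ (suc n) U) + ∑ (suc n) (λ j → - 1# * (x₀ * U j) + sign j * (y j * Q′ j))
    ≈⟨ +-congˡ (∑-distrib-+ (suc n) (λ j → - 1# * (x₀ * U j)) (λ j → sign j * (y j * Q′ j))) ⟩
      1# * (x₀ * ∑ (suc n) U) + (∑ (suc n) (λ j → - 1# * (x₀ * U j)) + R)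
    ≈⟨ +-congˡ (+-congʳ (sym (trans (*-congˡ (*-distribˡ-∑ (suc n) x₀ U))
                                    (*-distribˡ-∑ (suc n) (- 1#) (λ j → x₀ * U j))))) ⟩
      1# * (x₀ * ∑ (suc n) U) + (- 1# * (x₀ * ∑ (suc n) U) + R)
    ≈⟨ cancel (x₀ * ∑ (suc n) U) R ⟩
      R
    ∎
    where
    x₀ : Carrier
    x₀ = x zero
    y V U : Fin (suc n) → Carrier
    y = tail x
    V j = W (suc ∘ punchIn j)
    U j = sign j * (y j * V j)
    Q Q′ : Fin (suc n) → Carrier
    Q  j = ∑ n λ k → sign (suc k) * (y (punchIn j k) * W (punchIn (suc j) ∘ punchIn (suc k)))
    Q′ j = ∑ n λ k → sign k * (y (punchIn j k) * W (punchIn (suc j) ∘ punchIn (suc k)))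
    R : Carrier
    R = ∑ (suc n) λ j → sign j * (y j * Q′ j)
    Q≈-Q′ : ∀ j → Q j ≈ - 1# * Q′ j
    Q≈-Q′ j = trans (∑-cong n λ k → *-assoc _ _ _) (sym (*-distribˡ-∑ n (- 1#) _))
    split : ∀ j → sign (suc j) * (y j * (1# * (x₀ * V j) + Q j)) ≈
                  - 1# * (x₀ * U j) + sign j * (y j * Q′ j)
    split j = trans (*-*-congˡ (sign (suc j)) (y j) (+-congˡ (Q≈-Q′ j)))
                    (regroup (sign j) (y j) x₀ (V j) (Q′ j))
      where
      regroup : ∀ s y z v q → (- 1# * s) * (y * (1# * (z * v) + - 1# * q)) ≈
                              - 1# * (z * (s * (y * v))) + s * (y * q)
      regroup = solve 5 (λ s y z v q →
        (:- con (+ 1) :* s) :* (y :* (con (+ 1) :* (z :* v) :+ :- con (+ 1) :* q))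
          := :- con (+ 1) :* (z :* (s :* (y :* v))) :+ s :* (y :* q)) refl
    cancel : ∀ t r → 1# * t + (- 1# * t + r) ≈ r
    cancel = solve 2 (λ t r → con (+ 1) :* t :+ (:- con (+ 1) :* t :+ r) := r) refl

  lift₁-cong : ∀ {m n} {e e′ : Fin m → Fin n} → e ≗ e′ → lift 1 e ≗ lift 1 e′
  lift₁-cong e≗e′ zero    = ≡.refl
  lift₁-cong e≗e′ (suc l) = ≡.cong suc (e≗e′ l)

  punchIn-suc∘punchIn-suc : ∀ {n} (j : Fin (suc (suc n))) (k : Fin (suc n)) →
    punchIn (suc j) ∘ punchIn (suc k) ≗ lift 1 (punchIn j ∘ punchIn k)
  punchIn-suc∘punchIn-suc j k zero    = ≡.refl
  punchIn-suc∘punchIn-suc j k (suc l) = ≡.refl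

  pairExpansion≈0 : ∀ n x W → (∀ {e e′} → e ≗ e′ → W e ≈ W e′) → pairExpansion n x W ≈ 0#
  pairExpansion≈0 zero x W W-cong =
    trans (pairExpansion-cancel zero x W) (∑-zero 1 λ j → *-*-zeroʳ (sign j) (x (suc j)) refl)
  pairExpansion≈0 (suc n) x W W-cong = begin
      pairExpansion (suc n) x W
    ≈⟨ pairExpansion-cancel (suc n) x W ⟩
      _
    ≈⟨ ∑-cong (suc (suc n)) (λ j → *-*-congˡ (sign j) (x (suc j))
         (∑-cong (suc n) λ k → *-*-congˡ (sign k) (x (suc (punchIn j k)))
           (W-cong (punchIn-suc∘punchIn-suc j k)))) ⟩
      pairExpansion n (tail x) (W ∘ lift 1)
    ≈⟨ pairExpansion≈0 n (tail x) (W ∘ lift 1) (W-cong ∘ lift₁-cong) ⟩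
      0#
    ∎

  det-repeatedRow : ∀ n (x : Fin (suc (suc n)) → Carrier) B → det (suc (suc n)) (x ∷ x ∷ B) ≈ 0#
  det-repeatedRow n x B = pairExpansion≈0 n x (λ e → det n (λ i l → B i (e l)))
    (λ e≗e′ → det-cong n λ i l → reflexive (≡.cong (B i) (e≗e′ l)))

  det-row₁-−-row₀ : ∀ n (x y : Fin (suc (suc n)) → Carrier) B →
    det (suc (suc n)) (x ∷ (λ j → y j - x j) ∷ B) ≈ det (suc (suc n)) (x ∷ y ∷ B)
  det-row₁-−-row₀ n x y B = begin
      det (suc (suc n)) (x ∷ (λ j → y j - x j) ∷ B)
    ≈⟨ ∑-cong (suc (suc n)) (λ j → trans
         (*-*-congˡ (sign j) (x j) (det-row₀-− n (y ∘ punchIn j) (x ∘ punchIn j) (B′ j)))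
         (expand-− (sign j) (x j) _ _)) ⟩
      ∑ (suc (suc n)) (λ j → cofactorTerm (x ∷ y ∷ B) j - cofactorTerm (x ∷ x ∷ B) j)
    ≈⟨ ∑-distrib-− (suc (suc n)) (cofactorTerm (x ∷ y ∷ B)) (cofactorTerm (x ∷ x ∷ B)) ⟩
      det (suc (suc n)) (x ∷ y ∷ B) - det (suc (suc n)) (x ∷ x ∷ B)
    ≈⟨ +-congˡ (trans (-‿cong (det-repeatedRow n x B)) -0#≈0#) ⟩
      det (suc (suc n)) (x ∷ y ∷ B) + 0#
    ≈⟨ +-identityʳ _ ⟩
      det (suc (suc n)) (x ∷ y ∷ B)
    ∎
    where
    B′ : Fin (suc (suc n)) → Fin n → Fin (suc n) → Carrier
    B′ j i k = B i (punchIn j k)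
    expand-− : ∀ s x p q → s * (x * (p - q)) ≈ s * (x * p) - s * (x * q)
    expand-− = solve 4 (λ s x p q → s :* (x :* (p :- q)) := s :* (x :* p) :- s :* (x :* q)) refl

  det-zeroColumn : ∀ n (M : Matrix (suc n)) → (∀ i → M i zero ≈ 0#) → det (suc n) M ≈ 0#
  det-zeroColumn n M M≈0 = ∑-zero (suc n) (cofactor≈0 n M M≈0)
    where
    cofactor≈0 : ∀ n (M : Matrix (suc n)) → (∀ i → M i zero ≈ 0#) → ∀ j → cofactorTerm M j ≈ 0#
    cofactor≈0 n       M M≈0 zero    = trans (*-congˡ (trans (*-congʳ (M≈0 zero)) (zeroˡ _))) (zeroʳ _)
    cofactor≈0 (suc n) M M≈0 (suc j) =
      *-*-zeroʳ (sign (suc j)) (M zero (suc j)) (det-zeroColumn n (minor M (suc j)) (M≈0 ∘ suc))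

  det-expand-column₀ : ∀ n (M : Matrix (suc n)) → (∀ i → M (suc i) zero ≈ 0#) →
    det (suc n) M ≈ M zero zero * det n (λ i k → M (suc i) (suc k))
  det-expand-column₀ n M M≈0 =
    trans (+-congˡ (∑-zero n (cofactor≈0 n M M≈0))) (trans (+-identityʳ _) (*-identityˡ _))
    where
    cofactor≈0 : ∀ n (M : Matrix (suc n)) → (∀ i → M (suc i) zero ≈ 0#) →
      ∀ j → cofactorTerm M (suc j) ≈ 0#
    cofactor≈0 (suc n) M M≈0 j =
      *-*-zeroʳ (sign (suc j)) (M zero (suc j)) (det-zeroColumn n (minor M (suc j)) M≈0)

  rowDifferences : ∀ {n k} → (Fin (suc n) → Fin k → Carrier) → Fin (suc n) → Fin k → Carrier
  rowDifferences A zero    j = A zero j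
  rowDifferences A (suc i) j = A (suc i) j - A (inject₁ i) j

  det-rowDifferences : ∀ n (A : Matrix (suc n)) → det (suc n) (rowDifferences A) ≈ det (suc n) A
  det-rowDifferences zero    A = refl
  det-rowDifferences (suc n) A = begin
    det (suc (suc n)) (rowDifferences A)
      ≡⟨⟩
    det (suc (suc n)) (A zero ∷ (λ j → A (suc zero) j - A zero j) ∷ (rowDifferences (tail A) ∘ suc))
      ≈⟨ det-row₁-−-row₀ n (A zero) (A (suc zero)) (rowDifferences (tail A) ∘ suc) ⟩
    det (suc (suc n)) (A zero ∷ rowDifferences (tail A))
      ≈⟨ ∑-cong (suc (suc n)) (λ j → *-*-congˡ (sign j) (A zero j) (det-rowDifferences n (minor A j))) ⟩
    det (suc (suc n)) A
      ∎

  -- Poly d L f: f agrees with a polynomial in i of degree at most d whose coefficient of i ^ d is L.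
  data Poly : ℕ → Carrier → (ℕ → Carrier) → Set (a ⊔ ℓ) where
    constant : ∀ {L f} → (∀ i → f i ≈ L) → Poly zero L f
    horner   : ∀ {d L f} (g : ℕ → Carrier) (c : Carrier) → Poly d L g →
               (∀ i → f i ≈ fromℕ i * g i + c) → Poly (suc d) L f

  poly₀-value : ∀ {L f} → Poly zero L f → ∀ i → f i ≈ L
  poly₀-value (constant f≈L) = f≈L

  poly-cong : ∀ {d L f f′} → (∀ i → f′ i ≈ f i) → Poly d L f → Poly d L f′
  poly-cong f′≈f (constant f≈L)   = constant λ i → trans (f′≈f i) (f≈L i)
  poly-cong f′≈f (horner g c p e) = horner g c p λ i → trans (f′≈f i) (e i)

  poly-leading-cong : ∀ {d L L′ f} → L ≈ L′ → Poly d L f → Poly d L′ f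
  poly-leading-cong L≈L′ (constant f≈L)   = constant λ i → trans (f≈L i) L≈L′
  poly-leading-cong L≈L′ (horner g c p e) = horner g c (poly-leading-cong L≈L′ p) e

  poly-weaken : ∀ {d L f} → Poly d L f → Poly (suc d) 0# f
  poly-weaken {L = L} (constant f≈L) = horner (λ _ → 0#) L (constant λ _ → refl)
    λ i → trans (f≈L i) (sym (trans (+-congʳ (zeroʳ _)) (+-identityˡ L)))
  poly-weaken (horner g c p e) = horner g c (poly-weaken p) e

  poly-zero : ∀ d → Poly d 0# (λ _ → 0#)
  poly-zero zero    = constant λ _ → refl
  poly-zero (suc d) = poly-weaken (poly-zero d)

  poly-+ : ∀ {d L L′ f f′} → Poly d L f → Poly d L′ f′ → Poly d (L + L′) (λ i → f i + f′ i)
  poly-+ (constant f≈L) (constant f′≈L′) = constant λ i → +-cong (f≈L i) (f′≈L′ i)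
  poly-+ (horner g c p e) (horner g′ c′ p′ e′) = horner (λ i → g i + g′ i) (c + c′) (poly-+ p p′)
    λ i → trans (+-cong (e i) (e′ i)) (collect (fromℕ i) _ _ _ _)
    where
    collect : ∀ x u c v c′ → (x * u + c) + (x * v + c′) ≈ x * (u + v) + (c + c′)
    collect = solve 5 (λ x u c v c′ → (x :* u :+ c) :+ (x :* v :+ c′) := x :* (u :+ v) :+ (c :+ c′)) refl

  poly-scale : ∀ {d L f} r → Poly d L f → Poly d (r * L) (λ i → r * f i)
  poly-scale r (constant f≈L)   = constant λ i → *-congˡ (f≈L i)
  poly-scale r (horner g c p e) = horner (λ i → r * g i) (r * c) (poly-scale r p)
    λ i → trans (*-congˡ (e i)) (distribute r (fromℕ i) _ _)
    where
    distribute : ∀ r x u c → r * (x * u + c) ≈ x * (r * u) + r * c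
    distribute = solve 4 (λ r x u c → r :* (x :* u :+ c) := x :* (r :* u) :+ r :* c) refl

  poly-X* : ∀ {d L f} → Poly d L f → Poly (suc d) L (λ i → fromℕ i * f i)
  poly-X* {f = f} p = horner f 0# p λ i → sym (+-identityʳ _)

  poly-linear-* : ∀ {d L f} r c → Poly d L f → Poly (suc d) (r * L) (λ i → (r * fromℕ i + c) * f i)
  poly-linear-* r c p =
    poly-cong (λ i → expand (fromℕ i) _)
      (poly-leading-cong (+-identityʳ _) (poly-+ (poly-X* (poly-scale r p)) (poly-weaken (poly-scale c p))))
    where
    expand : ∀ x y → (r * x + c) * y ≈ x * (r * y) + c * y
    expand = solve 4 (λ r c x y → (r :* x :+ c) :* y := x :* (r :* y) :+ c :* y) refl r c

  poly-∑ : ∀ {d} m {f : Fin m → ℕ → Carrier} {L : Fin m → Carrier} →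
    (∀ s → Poly d (L s) (f s)) → Poly d (∑ m L) (λ i → ∑ m (λ s → f s i))
  poly-∑ {d} zero    p = poly-zero d
  poly-∑     (suc m) p = poly-+ (p zero) (poly-∑ m (p ∘ suc))

  Δ : (ℕ → Carrier) → ℕ → Carrier
  Δ f i = f (suc i) - f i

  Δ-horner : ∀ {f g c} → (∀ i → f i ≈ fromℕ i * g i + c) →
    ∀ i → Δ f i ≈ fromℕ i * Δ g i + (Δ g i + g i)
  Δ-horner {g = g} {c} e i =
    trans (+-cong (e (suc i)) (-‿cong (e i))) (expand (fromℕ i) (g (suc i)) (g i) c)
    where
    expand : ∀ x u v c → ((1# + x) * u + c) - (x * v + c) ≈ x * (u - v) + ((u - v) + v)
    expand = solve 4 (λ x u v c → ((con (+ 1) :+ x) :* u :+ c) :- (x :* v :+ c)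
                                 := x :* (u :- v) :+ ((u :- v) :+ v)) refl

  poly-Δ : ∀ {d L f} → Poly (suc d) L f → Poly d (fromℕ (suc d) * L) (Δ f)
  poly-Δ {zero} {L} {f} (horner g c (constant g≈L) e) = constant λ i → begin
    Δ f i                              ≈⟨ Δ-horner e i ⟩
    fromℕ i * Δ g i + (Δ g i + g i)    ≈⟨ +-cong (*-congˡ Δg≈0) (+-cong Δg≈0 (g≈L i)) ⟩
    fromℕ i * 0# + (0# + L)            ≈⟨ simplify (fromℕ i) L ⟩
    fromℕ 1 * L                        ∎
    where
    Δg≈0 : ∀ {i} → Δ g i ≈ 0#
    Δg≈0 {i} = trans (+-cong (g≈L (suc i)) (-‿cong (g≈L i))) (-‿inverseʳ L)
    simplify : ∀ x L → x * 0# + (0# + L) ≈ (1# + 0#) * L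
    simplify = solve 2 (λ x L → x :* con (+ 0) :+ (con (+ 0) :+ L) := (con (+ 1) :+ con (+ 0)) :* L) refl
  poly-Δ {suc d} {L} (horner g c p e) =
    poly-cong (Δ-horner e)
      (poly-leading-cong (collect (fromℕ (suc d)) L)
        (poly-+ (poly-X* (poly-Δ p)) (poly-+ (poly-weaken (poly-Δ p)) p)))
    where
    collect : ∀ n L → n * L + (0# + L) ≈ (1# + n) * L
    collect = solve 2 (λ n L → n :* L :+ (con (+ 0) :+ L) := (con (+ 1) :+ n) :* L) refl

  poly-∏-linear : ∀ r j (c : Fin j → Carrier) → Poly j (r ^ j) (λ i → ∏ j λ k → r * fromℕ i + c k)
  poly-∏-linear r zero    c = constant λ _ → refl
  poly-∏-linear r (suc j) c = poly-linear-* r (c zero) (poly-∏-linear r j (c ∘ suc))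

  factorial⁻¹ : ℕ → Carrier
  factorial⁻¹ t = inv (fromℕ (t !)) (charZero (t !) {{t !≢0}})

  poly-binom : ∀ r j → Poly j (r ^ j * factorial⁻¹ j) (λ i → binom (r * fromℕ i) j)
  poly-binom r j =
    poly-cong (λ i → *-comm _ _)
      (poly-leading-cong (*-comm _ _)
        (poly-scale (factorial⁻¹ j) (poly-∏-linear r j λ k → - fromℕ (toℕ k))))

  det-polynomialColumns : ∀ n (q : Fin n → ℕ → Carrier) (L : Fin n → Carrier) →
    (∀ j → Poly (toℕ j) (L j) (q j)) →
    det n (λ i j → q j (toℕ i)) ≈ ∏ n (λ j → fromℕ (toℕ j !) * L j)
  det-polynomialColumns zero    q L q-poly = refl
  det-polynomialColumns (suc n) q L q-poly = begin
      det (suc n) A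
    ≈⟨ det-rowDifferences n A ⟨
      det (suc n) (rowDifferences A)
    ≈⟨ det-expand-column₀ n (rowDifferences A) (λ i → Δq₀≈0) ⟩
      q zero 0 * det n (λ i k → rowDifferences A (suc i) (suc k))
    ≈⟨ *-cong (q₀≈L₀ 0) (det-cong n rowDifferences≈Δ) ⟩
      L zero * det n (λ i k → Δ (q (suc k)) (toℕ i))
    ≈⟨ *-congˡ (det-polynomialColumns n (λ k → Δ (q (suc k))) (λ k → fromℕ (suc (toℕ k)) * L (suc k))
                  (λ k → poly-Δ (q-poly (suc k)))) ⟩
      L zero * ∏ n (λ k → fromℕ (toℕ k !) * (fromℕ (suc (toℕ k)) * L (suc k)))
    ≈⟨ *-cong (sym (trans (*-congʳ (+-identityʳ 1#)) (*-identityˡ _)))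
              (∏-cong n λ k → factorial-suc (toℕ k) _) ⟩
      ∏ (suc n) (λ j → fromℕ (toℕ j !) * L j)
    ∎
    where
    A : Matrix (suc n)
    A i j = q j (toℕ i)
    rowDifferences≈Δ : ∀ i k → rowDifferences A (suc i) (suc k) ≈ Δ (q (suc k)) (toℕ i)
    rowDifferences≈Δ i k = +-congˡ (-‿cong (reflexive (≡.cong (q (suc k)) (toℕ-inject₁ i))))
    factorial-suc : ∀ t x → fromℕ (t !) * (fromℕ (suc t) * x) ≈ fromℕ (suc t !) * x
    factorial-suc t x = trans (x∙yz≈yx∙z _ _ _) (*-congʳ (sym (fromℕ-homo-* (suc t) (t !))))
    q₀≈L₀ : ∀ i → q zero i ≈ L zero
    q₀≈L₀ = poly₀-value (q-poly zero)
    Δq₀≈0 : ∀ {i j} → q zero j - q zero i ≈ 0#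
    Δq₀≈0 {i} {j} = trans (+-cong (q₀≈L₀ j) (-‿cong (q₀≈L₀ i))) (-‿inverseʳ _)

  fromℕ-!-cancels-factorial⁻¹ : ∀ t y x → fromℕ (t !) * (y * (x * factorial⁻¹ t)) ≈ y * x
  fromℕ-!-cancels-factorial⁻¹ t y x = begin
    fromℕ (t !) * (y * (x * factorial⁻¹ t))    ≈⟨ x∙yz≈y∙xz _ _ _ ⟩
    y * (fromℕ (t !) * (x * factorial⁻¹ t))    ≈⟨ *-congˡ (x∙yz≈y∙xz _ _ _) ⟩
    y * (x * (fromℕ (t !) * factorial⁻¹ t))    ≈⟨ *-congˡ (*-congˡ (inv-law _ _)) ⟩
    y * (x * 1#)                               ≈⟨ *-congˡ (*-identityʳ x) ⟩
    y * x                                      ∎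

mainTheorem6 : ∀ {a ℓ : Level} (F : CharZeroField a ℓ) → let open CZF F in
    (m : ℕ) (r : Fin m → Carrier) → (∀ x y → r x ≈ r y → x ≡ y) →
    (c : Fin m → Carrier) → (n : ℕ) →
    det (suc n) (λ i j → ∑ m (λ s → c s * binom (r s * fromℕ (toℕ i)) (toℕ j)))
      ≈ ∏ (suc n) (λ j → ∑ m (λ s → c s * (r s ^ toℕ j)))
-- The r s need not be distinct.
mainTheorem6 F m r _ c n = begin
    det (suc n) (λ i j → q j (toℕ i))
  ≈⟨ det-polynomialColumns (suc n) q L q-poly ⟩
    ∏ (suc n) (λ j → fromℕ (toℕ j !) * L j)
  ≈⟨ ∏-cong (suc n) j!L≈∑cr^j ⟩
    ∏ (suc n) (λ j → ∑ m (λ s → c s * (r s ^ toℕ j)))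
  ∎
  where
  open CZF F
  open BinomialDeterminant F
  open import Relation.Binary.Reasoning.Setoid setoid
  q : Fin (suc n) → ℕ → Carrier
  q j i = ∑ m λ s → c s * binom (r s * fromℕ i) (toℕ j)
  L : Fin (suc n) → Carrier
  L j = ∑ m λ s → c s * (r s ^ toℕ j * factorial⁻¹ (toℕ j))
  q-poly : ∀ j → Poly (toℕ j) (L j) (q j)
  q-poly j = poly-∑ m λ s → poly-scale (c s) (poly-binom (r s) (toℕ j))
  j!L≈∑cr^j : ∀ j → fromℕ (toℕ j !) * L j ≈ ∑ m (λ s → c s * (r s ^ toℕ j))
  j!L≈∑cr^j j = trans (*-distribˡ-∑ m _ _)
    (∑-cong m λ s → fromℕ-!-cancels-factorial⁻¹ (toℕ j) (c s) (r s ^ toℕ j))
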